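{- For every integer $j \ge 0$, \[ \frac{1}{(j+2)!} \le \liminf_{n\to\infty} \frac{s_j(n)}{n} \le \limsup_{n\to\infty} \frac{s_j(n)}{n} \le \frac{1}{j+2}. \]
   Context: For positive integers $n,k$, $n \bmod k$ denotes the least nonnegative remainder of $n$ upon division by $k$. For a positive integer $n$, define the iterated remainder sets inductively by $S_0(n) := \{1,2,\ldots,\lfloor n/2\rfloor\}$ and $S_j(n) := \{ n \bmod k : k \in S_{j-1}(n)\setminus\{0\}\}$ for $j \ge 1$, and let $s_j(n) := |S_j(n)|$. -}

module Defs where

open import Data.Nat using (ℕ; zero; suc; _+_; _*_; _≤_; _/_; _%_)
open import Data.Nat.Properties using (_≟_)
open import Data.List using (List; map; filter; upTo; length; deduplicate)
open import Data.Product using (∃-syntax)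
open import Relation.Nullary using (¬?)

-- n mod k, for k ≠ 0 (the value at k = 0 is never used: zeros are filtered out)
modNZ : ℕ → ℕ → ℕ
modNZ n zero    = zero
modNZ n (suc k) = n % suc k

S : ℕ → ℕ → List ℕ
S zero    n = map suc (upTo (n / 2))
S (suc j) n = deduplicate _≟_
                (map (modNZ n) (filter (λ k → ¬? (k ≟ 0)) (S j n)))

s : ℕ → ℕ → ℕ
s j n = length (deduplicate _≟_ (S j n))

-- liminf_{n→∞} a(n)/n ≥ p/q  (q > 0), unfolded: for every ε = 1/(m+1),
-- eventually a(n)/n ≥ p/q − 1/(m+1), i.e. (cross-multiplied, n ≥ 1)
--   n·p·(m+1) ≤ a(n)·q·(m+1) + n·q
LiminfRatioGe : (ℕ → ℕ) → ℕ → ℕ → Set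
LiminfRatioGe a p q = ∀ m → ∃[ N ] ∀ n → N ≤ n →
  n * p * suc m ≤ a n * q * suc m + n * q

-- limsup_{n→∞} a(n)/n ≤ p/q  (q > 0), unfolded: for every ε = 1/(m+1),
-- eventually a(n)/n ≤ p/q + 1/(m+1), i.e.  a(n)·q·(m+1) ≤ n·p·(m+1) + n·q
LimsupRatioLe : (ℕ → ℕ) → ℕ → ℕ → Set
LimsupRatioLe a p q = ∀ m → ∃[ N ] ∀ n → N ≤ n →
  a n * q * suc m ≤ n * p * suc m + n * q

-- Upper bound: every x ∈ S_j(n) has (j + 2) x ≤ n, because if (j + 2) k ≤ n then n = q k + (n mod k)
-- with q ≥ j + 2 and n mod k ≤ k, so (j + 3)(n mod k) ≤ n; hence s_j(n) ≤ n / (j + 2) + 1.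
-- Lower bound: if n = (i + 2) yᵢ + yᵢ₊₁ for all i < j and (j + 2) y_j < n, then y_j ∈ S_j(n).
-- By induction on j, every interval of length (j + 1)! below n contains the last term y_j of such a
-- chain, so the ⌊(n − 1)/(j + 2)!⌋ disjoint intervals of that length below n/(j + 2) give as many
-- distinct elements of S_j(n).
{-# OPTIONS --safe #-}
module Submission where

open import Defs
open import Data.Nat using (ℕ; _+_; _!)
open import Data.Product using (_×_)

open import Data.Fin using (Fin; toℕ)
open import Data.Fin.Properties using (injective⇒≤; toℕ-injective; toℕ<n)
open import Data.List using (List; lookup; length; upTo; deduplicate)
open import Data.List.Membership.Propositional using (_∈_)
open import Data.List.Membership.Propositional.Properties
  using (∈-lookup; ∈-upTo⁺; ∈-upTo⁻; ∈-map⁺; ∈-map⁻; ∈-filter⁺; ∈-filter⁻; ∈-deduplicate⁺; ∈-deduplicate⁻)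
open import Data.List.Properties using (length-upTo)
open import Data.List.Relation.Unary.All as All using ()
open import Data.List.Relation.Unary.AllPairs using (_∷_)
open import Data.List.Relation.Unary.Any using (index)
open import Data.List.Relation.Unary.Any.Properties using (lookup-index)
open import Data.List.Relation.Unary.Unique.Propositional using (Unique)
open import Data.Nat.Base
  using (zero; suc; _*_; _∸_; _≤_; _<_; z≤n; s≤s; z<s; NonZero; >-nonZero; _/_; _%_)
open import Data.Nat.DivMod
open import Data.Nat.Properties
open import Data.List.Relation.Unary.Unique.DecPropositional.Properties _≟_ using (deduplicate-!)
open import Algebra.Properties.CommutativeSemigroup *-commutativeSemigroup using (x∙yz≈y∙xz)
open import Data.Nat.Tactic.RingSolver using (solve-∀)
open import Data.Product using (∃-syntax; _,_; proj₁; proj₂)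
open import Data.Unit using (⊤; tt)
open import Function.Definitions using (Injective)
open import Relation.Binary.PropositionalEquality
open import Relation.Nullary using (Dec; ¬?; contradiction)

module _ {a} {A : Set a} where

  lookup-injective : ∀ {xs : List A} → Unique xs → Injective _≡_ _≡_ (lookup xs)
  lookup-injective (_ ∷ _)         {Fin.zero}  {Fin.zero}  _  = refl
  lookup-injective (x∉xs ∷ _)      {Fin.zero}  {Fin.suc i} eq = contradiction eq (All.lookup x∉xs (∈-lookup i))
  lookup-injective (x∉xs ∷ _)      {Fin.suc i} {Fin.zero}  eq = contradiction (sym eq) (All.lookup x∉xs (∈-lookup i))
  lookup-injective (_ ∷ xs-unique) {Fin.suc i} {Fin.suc k} eq = cong Fin.suc (lookup-injective xs-unique eq)

  injective⇒≤length : ∀ {m} {ys : List A} {f : Fin m → A} →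
                      Injective _≡_ _≡_ f → (f∈ys : ∀ i → f i ∈ ys) → m ≤ length ys
  injective⇒≤length {ys = ys} {f} f-injective f∈ys = injective⇒≤ index-injective
    where
    open ≡-Reasoning
    index-injective : Injective _≡_ _≡_ (λ i → index (f∈ys i))
    index-injective {i} {k} eq = f-injective (begin
      f i                        ≡⟨ lookup-index (f∈ys i) ⟩
      lookup ys (index (f∈ys i)) ≡⟨ cong (lookup ys) eq ⟩
      lookup ys (index (f∈ys k)) ≡⟨ lookup-index (f∈ys k) ⟨
      f k                        ∎)

unique-<⇒length≤ : ∀ {xs : List ℕ} {b} → Unique xs → (∀ {x} → x ∈ xs → x < b) → length xs ≤ b
unique-<⇒length≤ {xs} {b} xs-unique xs<b =
  subst (length xs ≤_) (length-upTo b)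
    (injective⇒≤length (lookup-injective xs-unique) (λ i → ∈-upTo⁺ (xs<b (∈-lookup i))))

m*n≤o⇒m≤o/n : ∀ m n {o} .{{_ : NonZero n}} → m * n ≤ o → m ≤ o / n
m*n≤o⇒m≤o/n m n m*n≤o = subst (_≤ _ / n) (m*n/n≡m m n) (/-monoˡ-≤ n m*n≤o)

o*n≤m⇒[1+o]*[m%n]≤m : ∀ m n o .{{_ : NonZero n}} → o * n ≤ m → suc o * (m % n) ≤ m
o*n≤m⇒[1+o]*[m%n]≤m m n o o*n≤m = begin
  m % n + o * (m % n) ≤⟨ +-monoʳ-≤ (m % n) (*-monoʳ-≤ o (m%n≤n m n)) ⟩
  m % n + o * n       ≤⟨ +-monoʳ-≤ (m % n) (*-monoˡ-≤ n (m*n≤o⇒m≤o/n o n o*n≤m)) ⟩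
  m % n + m / n * n   ≡⟨ m≡m%n+[m/n]*n m n ⟨
  m                   ∎
  where open ≤-Reasoning

m<n⇒k<o⇒m+k*n<o*n : ∀ {m n k o} → m < n → k < o → m + k * n < o * n
m<n⇒k<o⇒m+k*n<o*n {m} {n} {k} {o} m<n k<o = begin-strict
  m + k * n <⟨ +-monoˡ-< (k * n) m<n ⟩
  n + k * n ≤⟨ *-monoˡ-≤ n k<o ⟩
  o * n     ∎
  where open ≤-Reasoning

nonzero? : ∀ k → Dec (k ≢ 0)
nonzero? k = ¬? (k ≟ 0)

∈-S-zero⁻ : ∀ {n x} → x ∈ S 0 n → 2 * x ≤ n
∈-S-zero⁻ {n} x∈S with ∈-map⁻ suc x∈S
... | i , i∈upTo , refl = begin
  2 * suc i   ≤⟨ *-monoʳ-≤ 2 (∈-upTo⁻ i∈upTo) ⟩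
  2 * (n / 2) ≡⟨ *-comm 2 (n / 2) ⟩
  n / 2 * 2   ≤⟨ m/n*n≤m n 2 ⟩
  n           ∎
  where open ≤-Reasoning

∈-S-zero⁺ : ∀ {n x} → 2 * suc x ≤ n → suc x ∈ S 0 n
∈-S-zero⁺ {n} {x} 2x≤n =
  ∈-map⁺ suc (∈-upTo⁺ (m*n≤o⇒m≤o/n (suc x) 2 (subst (_≤ n) (*-comm 2 (suc x)) 2x≤n)))

∈-S-suc⁻ : ∀ {j n x} → x ∈ S (suc j) n → ∃[ k ] suc k ∈ S j n × x ≡ n % suc k
∈-S-suc⁻ {j} {n} x∈S with ∈-map⁻ (modNZ n) (∈-deduplicate⁻ _≟_ _ x∈S)
... | zero  , 0∈ , _   = contradiction refl (proj₂ (∈-filter⁻ nonzero? {xs = S j n} 0∈))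
... | suc k , k∈ , x≡ = k , proj₁ (∈-filter⁻ nonzero? {xs = S j n} k∈) , x≡

∈-S-suc⁺ : ∀ {j n k} .{{_ : NonZero k}} → k ∈ S j n → n % k ∈ S (suc j) n
∈-S-suc⁺ {n = n} {k = suc _} k∈S =
  ∈-deduplicate⁺ _≟_ (∈-map⁺ (modNZ n) (∈-filter⁺ nonzero? k∈S λ ()))

S-bounded : ∀ j n {x} → x ∈ S j n → (2 + j) * x ≤ n
S-bounded zero    n x∈S = ∈-S-zero⁻ x∈S
S-bounded (suc j) n x∈S with ∈-S-suc⁻ {j} x∈S
... | k , k∈S , refl = o*n≤m⇒[1+o]*[m%n]≤m n (suc k) (2 + j) (S-bounded j n k∈S)

s-upper-bound : ∀ j n → s j n * (2 + j) ≤ (2 + j) + n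
s-upper-bound j n = begin
  s j n * d         ≤⟨ *-monoˡ-≤ d s≤1+n/d ⟩
  d + n / d * d     ≤⟨ +-monoʳ-≤ d (m/n*n≤m n d) ⟩
  d + n             ∎
  where
  open ≤-Reasoning
  d = 2 + j
  s≤1+n/d : s j n ≤ suc (n / d)
  s≤1+n/d = unique-<⇒length≤ (deduplicate-! (S j n)) λ {x} x∈ →
    s≤s (m*n≤o⇒m≤o/n x d (subst (_≤ n) (*-comm d x) (S-bounded j n (∈-deduplicate⁻ _≟_ (S j n) x∈))))

RemainderChain : ℕ → ℕ → ℕ → Set
RemainderChain zero    n z = ⊤
RemainderChain (suc j) n z = ∃[ y ] n ≡ (2 + j) * y + z × RemainderChain j n y

-- Smallness of z forces z < y_{j-1} < … < y₀, so each yᵢ₊₁ is n mod yᵢ.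
chain⇒∈S : ∀ j n z → RemainderChain j n z → 0 < z → (2 + j) * z < n → z ∈ S j n
chain⇒∈S zero    n (suc z) _ _ 2z<n = ∈-S-zero⁺ (<⇒≤ 2z<n)
chain⇒∈S (suc j) n z (y , n≡dy+z , chain) 0<z [1+d]z<n =
  subst (_∈ S (suc j) n) n%y≡z (∈-S-suc⁺ {j} (chain⇒∈S j n y chain 0<y dy<n))
  where
  d = 2 + j
  z<y : z < y
  z<y = *-cancelˡ-< d z y (+-cancelˡ-< z (d * z) (d * y)
          (subst (z + d * z <_) (trans n≡dy+z (+-comm (d * y) z)) [1+d]z<n))
  0<y : 0 < y
  0<y = <-trans 0<z z<y
  instance
    y≢0 : NonZero y
    y≢0 = >-nonZero 0<y
  dy<n : d * y < n
  dy<n = subst (d * y <_) (sym n≡dy+z) (m<m+n (d * y) 0<z)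
  n%y≡z : n % y ≡ z
  n%y≡z = begin
    n % y           ≡⟨ %-congˡ (trans n≡dy+z (+-comm (d * y) z)) ⟩
    (z + d * y) % y ≡⟨ [m+kn]%n≡m%n z d y ⟩
    z % y           ≡⟨ m<n⇒m%n≡m z<y ⟩
    z               ∎
    where open ≡-Reasoning

-- Writing n ∸ a = q * (j + 2) + r, each y ≤ q gives z = a + r + (q ∸ y) * (j + 2) with
-- n = (j + 2) * y + z, and z lies in [a, a + (j + 2)!) once y lies in (q ∸ (j + 1)!, q].
chain-step : ∀ j n a y → a ≤ n → y ≤ (n ∸ a) / (2 + j) → (n ∸ a) / (2 + j) < y + suc j ! →
             RemainderChain j n y → ∃[ z ] a ≤ z × z < a + (2 + j) ! × RemainderChain (suc j) n z
chain-step j n a y a≤n y≤q q<y+M chain = a + r + e * d , a≤z , z<a+dM , y , n≡dy+z , chain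
  where
  d = 2 + j
  M = suc j !
  D = n ∸ a
  q = D / d
  r = D % d
  e = q ∸ y
  y+e≡q : y + e ≡ q
  y+e≡q = m+[n∸m]≡n y≤q
  e<M : e < M
  e<M = +-cancelˡ-< y e M (subst (_< y + M) (sym y+e≡q) q<y+M)
  a≤z : a ≤ a + r + e * d
  a≤z = ≤-trans (m≤m+n a r) (m≤m+n (a + r) (e * d))
  z<a+dM : a + r + e * d < a + d * M
  z<a+dM = subst₂ _<_ (sym (+-assoc a r (e * d))) (cong (a +_) (*-comm M d))
             (+-monoʳ-< a (m<n⇒k<o⇒m+k*n<o*n (m%n<n D d) e<M))
  regroup : ∀ a r y e d → a + (r + (y + e) * d) ≡ d * y + (a + r + e * d)
  regroup = solve-∀
  n≡dy+z : n ≡ d * y + (a + r + e * d)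
  n≡dy+z = begin
    n                       ≡⟨ m+[n∸m]≡n a≤n ⟨
    a + D                   ≡⟨ cong (a +_) (m≡m%n+[m/n]*n D d) ⟩
    a + (r + q * d)         ≡⟨ cong (λ x → a + (r + x * d)) y+e≡q ⟨
    a + (r + (y + e) * d)   ≡⟨ regroup a r y e d ⟩
    d * y + (a + r + e * d) ∎
    where open ≡-Reasoning

chain-in-window : ∀ j n a → a + suc j ! ≤ n →
                  ∃[ z ] a ≤ z × z < a + suc j ! × RemainderChain j n z
chain-in-window zero    n a _ = a , ≤-refl , m<m+n a z<s , tt
chain-in-window (suc j) n a a+dM≤n =
  let y , t<y , y≤t+M , chain = chain-in-window j n (suc t) 1+t+M≤n
  in  chain-step j n a y a≤n (≤-pred (subst (y <_) (cong suc t+M≡q) y≤t+M))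
        (subst (_< y + M) t+M≡q (+-monoˡ-< M t<y)) chain
  where
  d = 2 + j
  M = suc j !
  D = n ∸ a
  q = D / d
  t = q ∸ M
  a≤n : a ≤ n
  a≤n = m+n≤o⇒m≤o a a+dM≤n
  dM≤D : d * M ≤ D
  dM≤D = m+n≤o⇒m≤o∸n (d * M) (subst (_≤ n) (+-comm a (d * M)) a+dM≤n)
  M≤q : M ≤ q
  M≤q = m*n≤o⇒m≤o/n M d (subst (_≤ D) (*-comm d M) dM≤D)
  t+M≡q : t + M ≡ q
  t+M≡q = m∸n+n≡m M≤q
  q<n : q < n
  q<n = begin-strict
    q     <⟨ m<m*n q d {{>-nonZero (<-≤-trans (1≤n! (suc j)) M≤q)}} (s≤s (s≤s z≤n)) ⟩
    q * d ≤⟨ m/n*n≤m D d ⟩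
    D     ≤⟨ m∸n≤m n a ⟩
    n     ∎
    where open ≤-Reasoning
  1+t+M≤n : suc t + M ≤ n
  1+t+M≤n = subst (λ x → suc x ≤ n) (sym t+M≡q) q<n

T*[2+j]!<n⇒T≤s : ∀ j n T → T * (2 + j) ! < n → T ≤ s j n
T*[2+j]!<n⇒T≤s j n T TF<n = injective⇒≤length pick-injective pick∈S
  where
  d = 2 + j
  M = suc j !
  window : (i : Fin T) → ∃[ z ] suc (toℕ i * M) ≤ z × z < suc (toℕ i * M) + M × RemainderChain j n z
  window i = chain-in-window j n (suc (toℕ i * M))
    (subst (λ x → suc x ≤ n) (+-comm M (toℕ i * M))
      (≤-<-trans (*-monoˡ-≤ M (toℕ<n i)) (≤-<-trans (*-monoʳ-≤ T (m≤n*m M d)) TF<n)))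
  pick : Fin T → ℕ
  pick i = proj₁ (window i)
  pick> : ∀ i → toℕ i * M < pick i
  pick> i = proj₁ (proj₂ (window i))
  pick≤ : ∀ i → pick i ≤ suc (toℕ i) * M
  pick≤ i = subst (pick i ≤_) (+-comm (toℕ i * M) M) (≤-pred (proj₁ (proj₂ (proj₂ (window i)))))
  pick-chain : ∀ i → RemainderChain j n (pick i)
  pick-chain i = proj₂ (proj₂ (proj₂ (window i)))
  pick-monotone : ∀ i k → pick i ≡ pick k → toℕ i ≤ toℕ k
  pick-monotone i k eq = ≤-pred (*-cancelʳ-< M (toℕ i) (suc (toℕ k))
    (<-≤-trans (pick> i) (subst (_≤ suc (toℕ k) * M) (sym eq) (pick≤ k))))
  pick-injective : Injective _≡_ _≡_ pick
  pick-injective {i} {k} eq = toℕ-injective (≤-antisym (pick-monotone i k eq) (pick-monotone k i (sym eq)))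
  d*pick<n : ∀ i → d * pick i < n
  d*pick<n i = begin-strict
    d * pick i  ≤⟨ *-monoʳ-≤ d (≤-trans (pick≤ i) (*-monoˡ-≤ M (toℕ<n i))) ⟩
    d * (T * M) ≡⟨ x∙yz≈y∙xz d T M ⟩
    T * (d * M) <⟨ TF<n ⟩
    n           ∎
    where open ≤-Reasoning
  pick∈S : ∀ i → pick i ∈ deduplicate _≟_ (S j n)
  pick∈S i = ∈-deduplicate⁺ _≟_ (chain⇒∈S j n (pick i) (pick-chain i) (≤-<-trans z≤n (pick> i)) (d*pick<n i))

s-lower-bound : ∀ j n → n ≤ (2 + j) ! + s j n * (2 + j) !
s-lower-bound j zero    = z≤n
s-lower-bound j (suc n) = begin
  suc n                  ≡⟨ cong suc (m≡m%n+[m/n]*n n F) ⟩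
  suc (n % F) + n / F * F ≤⟨ +-monoˡ-≤ (n / F * F) (m%n<n n F) ⟩
  F + n / F * F          ≤⟨ +-monoʳ-≤ F (*-monoˡ-≤ F (T*[2+j]!<n⇒T≤s j (suc n) (n / F) (s≤s (m/n*n≤m n F)))) ⟩
  F + s j (suc n) * F    ∎
  where
  open ≤-Reasoning
  F = (2 + j) !
  instance
    F≢0 : NonZero F
    F≢0 = (2 + j) !≢0

bound⇒LiminfRatioGe : ∀ a p q → (∀ n → n * p ≤ q + a n * q) → LiminfRatioGe a p q
bound⇒LiminfRatioGe a p q bound m = suc m , λ n m<n → begin
  n * p * suc m               ≤⟨ *-monoˡ-≤ (suc m) (bound n) ⟩
  (q + a n * q) * suc m       ≡⟨ *-distribʳ-+ (suc m) q (a n * q) ⟩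
  q * suc m + a n * q * suc m ≤⟨ +-monoˡ-≤ (a n * q * suc m) (*-monoʳ-≤ q m<n) ⟩
  q * n + a n * q * suc m     ≡⟨ +-comm (q * n) (a n * q * suc m) ⟩
  a n * q * suc m + q * n     ≡⟨ cong (a n * q * suc m +_) (*-comm q n) ⟩
  a n * q * suc m + n * q     ∎
  where open ≤-Reasoning

bound⇒LimsupRatioLe : ∀ a p q → (∀ n → a n * q ≤ q + n * p) → LimsupRatioLe a p q
bound⇒LimsupRatioLe a p q bound m = suc m , λ n m<n → begin
  a n * q * suc m             ≤⟨ *-monoˡ-≤ (suc m) (bound n) ⟩
  (q + n * p) * suc m         ≡⟨ *-distribʳ-+ (suc m) q (n * p) ⟩
  q * suc m + n * p * suc m   ≤⟨ +-monoˡ-≤ (n * p * suc m) (*-monoʳ-≤ q m<n) ⟩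
  q * n + n * p * suc m       ≡⟨ +-comm (q * n) (n * p * suc m) ⟩
  n * p * suc m + q * n       ≡⟨ cong (n * p * suc m +_) (*-comm q n) ⟩
  n * p * suc m + n * q       ∎
  where open ≤-Reasoning

theorem2p3 : (j : ℕ) →
    LiminfRatioGe (s j) 1 ((j + 2) !) × LimsupRatioLe (s j) 1 (j + 2)
theorem2p3 j rewrite +-comm j 2 =
    bound⇒LiminfRatioGe (s j) 1 ((2 + j) !)
      (λ n → ≤-trans (≤-reflexive (*-identityʳ n)) (s-lower-bound j n))
  , bound⇒LimsupRatioLe (s j) 1 (2 + j)
      (λ n → ≤-trans (s-upper-bound j n) (≤-reflexive (cong (2 + j +_) (sym (*-identityʳ n)))))
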